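{- Restricted to bipartite graphs, $\mathcal{H}_d(n)\le\mathcal{R}_d(n)$; that is, every edge set $G\subseteq\binom{[n]}{2}$ forming a bipartite graph that is independent in $\mathcal{H}_d(n)$ is also independent in $\mathcal{R}_d(n)$.
   Context: For $\mathbf{p}=(\mathbf{p}_1,\dots,\mathbf{p}_n)\in(\mathbb{R}^d)^n$, matrices have rows indexed by $\{i,j\}\in\binom{[n]}{2}$ ($i<j$) and $nd$ columns in $n$ blocks of size $d$, row $\{i,j\}$ zero outside blocks $i,j$. Bar-and-joint rigidity matrix: $\mathbf{p}_i-\mathbf{p}_j$ in block $i$, $\mathbf{p}_j-\mathbf{p}_i$ in block $j$. Hyperconnectivity matrix: $\mathbf{p}_j$ in block $i$, $-\mathbf{p}_i$ in block $j$. $\mathcal{R}_d(n)$ and $\mathcal{H}_d(n)$ denote the row matroids (ground set $\binom{[n]}{2}$) of these matrices for a sufficiently generic $\mathbf{p}\in(\mathbb{R}^d)^n$.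
   Formalization: The configurations $\mathbf{p}$ have rational coordinates, lying in (ℚ^d)^n rather than (ℝ^d)^n, and the rows of both matrices are tested for linear independence over ℚ. -}

module Defs where

open import Data.Nat using (ℕ; zero; suc; _<_)
open import Data.Fin using (Fin; toℕ) renaming (zero to fzero; suc to fsuc)
open import Data.Fin.Properties using (_≟_)
open import Data.Bool using (Bool; true)
open import Data.Product using (Σ; ∃; _×_)
open import Data.Rational using (ℚ; 0ℚ; _+_; _*_; _-_; -_)
open import Relation.Nullary using (¬_; yes; no)
open import Relation.Binary.PropositionalEquality using (_≡_)

sumFin : (n : ℕ) → (Fin n → ℚ) → ℚ
sumFin zero    f = 0ℚ
sumFin (suc n) f = f fzero + sumFin n (λ i → f (fsuc i))

Config : ℕ → ℕ → Set
Config n d = Fin n → Fin d → ℚ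

-- An edge set G ⊆ binom([n],2): the pair {i,j} with i<j (as ℕ) is in G iff G i j ≡ true.
-- Entries with toℕ i ≥ toℕ j are ignored.
EdgeSet : ℕ → Set
EdgeSet n = Fin n → Fin n → Bool

-- A matrix with rows indexed by pairs (i,j), i<j, and columns (k,a) ∈ [n]×[d]
-- (block k, coordinate a).
PairMatrix : ℕ → ℕ → Set
PairMatrix n d = Fin n → Fin n → Fin n → Fin d → ℚ

rigidityMatrix : ∀ {n d} → Config n d → PairMatrix n d
rigidityMatrix p i j k a with k ≟ i
... | yes _ = p i a - p j a
... | no  _ with k ≟ j
...   | yes _ = p j a - p i a
...   | no  _ = 0ℚ

hyperMatrix : ∀ {n d} → Config n d → PairMatrix n d
hyperMatrix p i j k a with k ≟ i
... | yes _ = p j a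
... | no  _ with k ≟ j
...   | yes _ = - p i a
...   | no  _ = 0ℚ

RowsIndependent : ∀ {n d} → PairMatrix n d → EdgeSet n → Set
RowsIndependent {n} {d} M G =
  (c : Fin n → Fin n → ℚ) →
  (∀ i j → ¬ (c i j ≡ 0ℚ) → (toℕ i < toℕ j) × (G i j ≡ true)) →
  (∀ k a → sumFin n (λ i → sumFin n (λ j → c i j * M i j k a)) ≡ 0ℚ) →
  ∀ i j → c i j ≡ 0ℚ

-- Independence in the generic row matroid of a matrix family: the rows are
-- independent for some (equivalently, for every sufficiently generic) configuration.
GenericIndependent : ∀ {n d} → (Config n d → PairMatrix n d) → EdgeSet n → Set
GenericIndependent {n} {d} M G = ∃ λ (p : Config n d) → RowsIndependent (M p) G

IndepR : (n d : ℕ) → EdgeSet n → Set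
IndepR n d G = GenericIndependent {n} {d} rigidityMatrix G

IndepH : (n d : ℕ) → EdgeSet n → Set
IndepH n d G = GenericIndependent {n} {d} hyperMatrix G

Bipartite : ∀ {n} → EdgeSet n → Set
Bipartite {n} G = ∃ λ (χ : Fin n → Bool) →
  ∀ i j → toℕ i < toℕ j → G i j ≡ true → ¬ (χ i ≡ χ j)

{-# OPTIONS --safe #-}
-- Choose a
-- linear functional μ vanishing at no nonzero p_i, and rescale every nonzero p_i to q_i
-- with μ(q_i) = ±1 according to the colour of i. A rigidity dependence c of q on G gives
-- the symmetric self-stress S = c + cᵀ: Σ_j S_kj (q_k − q_j) = 0, i.e.
-- Σ_j S_kj q_j = q_k Σ_j S_kj. At the vertices with q_k = 0 this makes the part of S
-- meeting them a symmetric hyperconnectivity stress Σ_j S_kj q_j = 0, which must vanish.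
-- At the other vertices every neighbour j has μ(q_j) = −μ(q_k), so applying μ gives
-- Σ_j S_kj = 0, and S itself is a hyperconnectivity stress. Finally, multiplying row i
-- of a symmetric hyperconnectivity stress by the colour sign ±1 of i makes it
-- antisymmetric on a bipartite graph, and its upper triangle is then a row dependence of
-- the hyperconnectivity matrix; rescaling the p_i does not affect this. So S = 0 and c = 0.

module Submission where

open import Defs
open import Data.Nat using (ℕ; zero; suc; _<_; _<?_)
open import Data.Nat.Properties using (<-cmp; <-irrefl; <-asym; n<1+n)
open import Data.Nat.Coprimality using (1-coprimeTo) renaming (sym to coprime-sym)
import Data.Integer.Base as ℤ
open import Data.Integer.Properties using (+-injective)
open import Data.Bool using (Bool; true; false; _∨_; if_then_else_)
open import Data.Bool.Properties using (∨-comm)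
open import Data.Fin using (Fin; toℕ; punchIn) renaming (zero to fzero; suc to fsuc)
open import Data.Fin.Properties
  using (_≟_; toℕ-injective; punchInᵢ≢i; all?; any?; ¬∀⟶∃¬; pigeonhole)
open import Data.Product using (∃; ∃₂; _×_; _,_; proj₁; proj₂; map₂)
open import Data.Sum using (_⊎_; inj₁; inj₂)
open import Data.Rational using (ℚ; 0ℚ; 1ℚ; _+_; _*_; _-_; -_; 1/_; mkℚ; ↥_)
open import Data.Rational.Base using (≢-nonZero)
import Data.Rational.Properties as ℚ
open import Data.Rational.Solver using (module +-*-Solver)
open +-*-Solver using (solve; _:=_; _:+_; _:*_; _:-_; :-_; con)
open import Algebra.Bundles using (CommutativeRing)
open import Algebra.Properties.Semiring.Sum (CommutativeRing.semiring ℚ.+-*-commutativeRing)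
  using ( sum-syntax; sum-cong-≗; sum-replicate-zero; sum-remove; ∑-distrib-+; ∑-comm
        ; *-distribˡ-sum; *-distribʳ-sum)
open import Algebra.Apartness.Properties.HeytingCommutativeRing ℚ.heytingCommutativeRing
  using (x#0y#0→xy#0)
open import Function using (_∘_; case_of_)
open import Relation.Nullary using (¬_; Dec; yes; no; does; contradiction)
open import Relation.Nullary.Decidable using (dec-true; dec-false; decidable-stable; _×-dec_; _→-dec_)
open import Relation.Binary.Definitions using (tri<; tri≈; tri>)
open import Relation.Binary.PropositionalEquality
  using (_≡_; _≢_; refl; sym; trans; cong; cong₂; subst; module ≡-Reasoning)
open ≡-Reasoning

private
  variable
    n d : ℕ

x*y≡0⇒y≡0 : ∀ {x y} → x ≢ 0ℚ → x * y ≡ 0ℚ → y ≡ 0ℚ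
x*y≡0⇒y≡0 {y = y} x≢0 xy≡0 =
  decidable-stable (y ℚ.≟ 0ℚ) (λ y≢0 → x#0y#0→xy#0 x≢0 y≢0 xy≡0)

x-y≡0⇒x≡y : ∀ {x y} → x - y ≡ 0ℚ → x ≡ y
x-y≡0⇒x≡y {x} {y} x-y≡0 = begin
  x             ≡⟨ solve 2 (λ x y → x := (x :- y) :+ y) refl x y ⟩
  (x - y) + y   ≡⟨ cong (_+ y) x-y≡0 ⟩
  0ℚ + y        ≡⟨ ℚ.+-identityˡ y ⟩
  y             ∎

x≡-x⇒x≡0 : ∀ {x} → x ≡ - x → x ≡ 0ℚ
x≡-x⇒x≡0 {x} x≡-x = x*y≡0⇒y≡0 {1ℚ + 1ℚ} (λ ()) (begin
  (1ℚ + 1ℚ) * x  ≡⟨ solve 1 (λ x → (con 1ℚ :+ con 1ℚ) :* x := x :+ x) refl x ⟩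
  x + x          ≡⟨ cong (x +_) x≡-x ⟩
  x + - x        ≡⟨ ℚ.+-inverseʳ x ⟩
  0ℚ             ∎)

sign : Bool → ℚ
sign true  = 1ℚ
sign false = - 1ℚ

sign≢0 : ∀ b → sign b ≢ 0ℚ
sign≢0 true  ()
sign≢0 false ()

sign-≢ : ∀ {b b′} → b ≢ b′ → sign b′ ≡ - sign b
sign-≢ {true}  {true}  b≢b′ = contradiction refl b≢b′
sign-≢ {true}  {false} _    = refl
sign-≢ {false} {true}  _    = refl
sign-≢ {false} {false} b≢b′ = contradiction refl b≢b′

sumFin≡∑ : ∀ n (f : Fin n → ℚ) → sumFin n f ≡ ∑[ i < n ] f i
sumFin≡∑ zero    f = refl
sumFin≡∑ (suc n) f = cong (f fzero +_) (sumFin≡∑ n (f ∘ fsuc))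

∑-zero : {f : Fin n → ℚ} → (∀ i → f i ≡ 0ℚ) → ∑[ i < n ] f i ≡ 0ℚ
∑-zero {n} f≡0 = trans (sum-cong-≗ f≡0) (sum-replicate-zero n)

∑-single : {f : Fin n → ℚ} (k : Fin n) → (∀ i → i ≢ k → f i ≡ 0ℚ) → ∑[ i < n ] f i ≡ f k
∑-single {suc n} {f} k off = begin
  ∑[ i < suc n ] f i
    ≡⟨ sum-remove {i = k} f ⟩
  f k + ∑[ i < n ] f (punchIn k i)
    ≡⟨ cong (f k +_) (∑-zero (λ i → off (punchIn k i) (punchInᵢ≢i k i))) ⟩
  f k + 0ℚ
    ≡⟨ ℚ.+-identityʳ (f k) ⟩
  f k
    ∎

∑-except : {f g : Fin n → ℚ} (k : Fin n) → (∀ i → i ≢ k → f i ≡ g i) →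
           ∑[ i < n ] f i ≡ (f k - g k) + ∑[ i < n ] g i
∑-except {n} {f} {g} k f≡g = begin
  ∑[ i < n ] f i
    ≡⟨ sum-cong-≗ (λ i → solve 2 (λ x y → x := (x :- y) :+ y) refl (f i) (g i)) ⟩
  ∑[ i < n ] ((f i - g i) + g i)
    ≡⟨ ∑-distrib-+ (λ i → f i - g i) g ⟩
  ∑[ i < n ] (f i - g i) + ∑[ i < n ] g i
    ≡⟨ cong (_+ ∑[ i < n ] g i) (∑-single k difference-off) ⟩
  (f k - g k) + ∑[ i < n ] g i
    ∎
  where
  difference-off : ∀ i → i ≢ k → f i - g i ≡ 0ℚ
  difference-off i i≢k = trans (cong (_- g i) (f≡g i i≢k)) (ℚ.+-inverseʳ (g i))

sumFin²≡∑² : (f : Fin n → Fin n → ℚ) →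
             sumFin n (λ i → sumFin n (f i)) ≡ ∑[ i < n ] ∑[ j < n ] f i j
sumFin²≡∑² {n} f =
  trans (sumFin≡∑ n (λ i → sumFin n (f i))) (sum-cong-≗ (λ i → sumFin≡∑ n (f i)))

blockMatrix : (X Y : Fin n → Fin n → Fin d → ℚ) → PairMatrix n d
blockMatrix X Y i j k a with k ≟ i
... | yes _ = X i j a
... | no  _ with k ≟ j
...   | yes _ = Y i j a
...   | no  _ = 0ℚ

module _ (X Y : Fin n → Fin n → Fin d → ℚ) where

  blockMatrix-i : ∀ i j a → blockMatrix X Y i j i a ≡ X i j a
  blockMatrix-i i j a with i ≟ i
  ... | yes _  = refl
  ... | no i≢i = contradiction refl i≢i

  blockMatrix-j : ∀ i j a → i ≢ j → blockMatrix X Y i j j a ≡ Y i j a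
  blockMatrix-j i j a i≢j with j ≟ i
  ... | yes j≡i = contradiction (sym j≡i) i≢j
  ... | no _ with j ≟ j
  ...   | yes _  = refl
  ...   | no j≢j = contradiction refl j≢j

  blockMatrix-off : ∀ i j k a → k ≢ i → k ≢ j → blockMatrix X Y i j k a ≡ 0ℚ
  blockMatrix-off i j k a k≢i k≢j with k ≟ i
  ... | yes k≡i = contradiction k≡i k≢i
  ... | no _ with k ≟ j
  ...   | yes k≡j = contradiction k≡j k≢j
  ...   | no _    = refl

  sumFin-column-blockMatrix :
    (M : PairMatrix n d) → (∀ i j k a → M i j k a ≡ blockMatrix X Y i j k a) →
    (c : Fin n → Fin n → ℚ) (k : Fin n) (a : Fin d) → c k k ≡ 0ℚ →
    sumFin n (λ i → sumFin n (λ j → c i j * M i j k a))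
      ≡ ∑[ j < n ] (c k j * X k j a) + ∑[ i < n ] (c i k * Y i k a)
  sumFin-column-blockMatrix M M≡block c k a ckk≡0 = begin
    sumFin n (λ i → sumFin n (λ j → c i j * M i j k a))
      ≡⟨ sumFin²≡∑² (λ i j → c i j * M i j k a) ⟩
    ∑[ i < n ] ∑[ j < n ] (c i j * M i j k a)
      ≡⟨ sum-cong-≗ (λ i → sum-cong-≗ (λ j → cong (c i j *_) (M≡block i j k a))) ⟩
    ∑[ i < n ] R i
      ≡⟨ ∑-except k R≡E ⟩
    (R k - E k) + ∑[ i < n ] E i
      ≡⟨ cong₂ (λ r e → (r - e) + ∑[ i < n ] E i) R-k E-k ⟩
    (∑[ j < n ] (c k j * X k j a) - 0ℚ) + ∑[ i < n ] E i
      ≡⟨ cong (_+ ∑[ i < n ] E i) (ℚ.+-identityʳ (∑[ j < n ] (c k j * X k j a))) ⟩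
    ∑[ j < n ] (c k j * X k j a) + ∑[ i < n ] E i
      ∎
    where
    R E : Fin n → ℚ
    R i = ∑[ j < n ] (c i j * blockMatrix X Y i j k a)
    E i = c i k * Y i k a

    R-k : R k ≡ ∑[ j < n ] (c k j * X k j a)
    R-k = sum-cong-≗ (λ j → cong (c k j *_) (blockMatrix-i k j a))

    E-k : E k ≡ 0ℚ
    E-k = trans (cong (_* Y k k a) ckk≡0) (ℚ.*-zeroˡ (Y k k a))

    R≡E : ∀ i → i ≢ k → R i ≡ E i
    R≡E i i≢k = trans (∑-single k off) (cong (c i k *_) (blockMatrix-j i k a i≢k))
      where
      off : ∀ j → j ≢ k → c i j * blockMatrix X Y i j k a ≡ 0ℚ
      off j j≢k = trans (cong (c i j *_) (blockMatrix-off i j k a (i≢k ∘ sym) (j≢k ∘ sym)))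
                        (ℚ.*-zeroʳ (c i j))

rigidityMatrix≡blockMatrix : ∀ (p : Config n d) i j k a →
  rigidityMatrix p i j k a ≡ blockMatrix (λ i j a → p i a - p j a) (λ i j a → p j a - p i a) i j k a
rigidityMatrix≡blockMatrix p i j k a with k ≟ i
... | yes _ = refl
... | no  _ with k ≟ j
...   | yes _ = refl
...   | no  _ = refl

hyperMatrix≡blockMatrix : ∀ (p : Config n d) i j k a →
  hyperMatrix p i j k a ≡ blockMatrix (λ i j a → p j a) (λ i j a → - p i a) i j k a
hyperMatrix≡blockMatrix p i j k a with k ≟ i
... | yes _ = refl
... | no  _ with k ≟ j
...   | yes _ = refl
...   | no  _ = refl

sumFin-column-rigidityMatrix : ∀ (q : Config n d) (c : Fin n → Fin n → ℚ) k a → c k k ≡ 0ℚ →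
  sumFin n (λ i → sumFin n (λ j → c i j * rigidityMatrix q i j k a))
    ≡ ∑[ j < n ] ((c k j + c j k) * (q k a - q j a))
sumFin-column-rigidityMatrix {n} q c k a ckk≡0 = begin
  sumFin n (λ i → sumFin n (λ j → c i j * rigidityMatrix q i j k a))
    ≡⟨ sumFin-column-blockMatrix _ _ (rigidityMatrix q) (rigidityMatrix≡blockMatrix q) c k a ckk≡0 ⟩
  ∑[ j < n ] (c k j * (q k a - q j a)) + ∑[ j < n ] (c j k * (q k a - q j a))
    ≡⟨ ∑-distrib-+ (λ j → c k j * (q k a - q j a)) (λ j → c j k * (q k a - q j a)) ⟨
  ∑[ j < n ] (c k j * (q k a - q j a) + c j k * (q k a - q j a))
    ≡⟨ sum-cong-≗ (λ j → ℚ.*-distribʳ-+ (q k a - q j a) (c k j) (c j k)) ⟨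
  ∑[ j < n ] ((c k j + c j k) * (q k a - q j a))
    ∎

sumFin-column-hyperMatrix : ∀ (p : Config n d) (c : Fin n → Fin n → ℚ) k a → c k k ≡ 0ℚ →
  sumFin n (λ i → sumFin n (λ j → c i j * hyperMatrix p i j k a))
    ≡ ∑[ j < n ] ((c k j - c j k) * p j a)
sumFin-column-hyperMatrix {n} p c k a ckk≡0 = begin
  sumFin n (λ i → sumFin n (λ j → c i j * hyperMatrix p i j k a))
    ≡⟨ sumFin-column-blockMatrix _ _ (hyperMatrix p) (hyperMatrix≡blockMatrix p) c k a ckk≡0 ⟩
  ∑[ j < n ] (c k j * p j a) + ∑[ j < n ] (c j k * - p j a)
    ≡⟨ ∑-distrib-+ (λ j → c k j * p j a) (λ j → c j k * - p j a) ⟨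
  ∑[ j < n ] (c k j * p j a + c j k * - p j a)
    ≡⟨ sum-cong-≗ (λ j → solve 3 (λ u v x → u :* x :+ v :* (:- x) := (u :- v) :* x) refl
                                 (c k j) (c j k) (p j a)) ⟩
  ∑[ j < n ] ((c k j - c j k) * p j a)
    ∎

upper : (Fin n → Fin n → ℚ) → Fin n → Fin n → ℚ
upper A i j with toℕ i <? toℕ j
... | yes _ = A i j
... | no  _ = 0ℚ

module _ (A : Fin n → Fin n → ℚ) where

  upper-< : ∀ {i j} → toℕ i < toℕ j → upper A i j ≡ A i j
  upper-< {i} {j} i<j with toℕ i <? toℕ j
  ... | yes _  = refl
  ... | no i≮j = contradiction i<j i≮j

  upper-≮ : ∀ {i j} → ¬ toℕ i < toℕ j → upper A i j ≡ 0ℚ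
  upper-≮ {i} {j} i≮j with toℕ i <? toℕ j
  ... | yes i<j = contradiction i<j i≮j
  ... | no _    = refl

  upper-≢0 : ∀ {i j} → upper A i j ≢ 0ℚ → toℕ i < toℕ j × A i j ≢ 0ℚ
  upper-≢0 {i} {j} Uij≢0 = case toℕ i <? toℕ j of λ where
    (yes i<j) → i<j , λ Aij≡0 → Uij≢0 (trans (upper-< i<j) Aij≡0)
    (no i≮j)  → contradiction (upper-≮ i≮j) Uij≢0

  upper-sub : (∀ i j → A j i ≡ - A i j) → ∀ i j → upper A i j - upper A j i ≡ A i j
  upper-sub anti i j with <-cmp (toℕ i) (toℕ j)
  ... | tri< i<j _ j≮i = begin
    upper A i j - upper A j i  ≡⟨ cong₂ _-_ (upper-< i<j) (upper-≮ j≮i) ⟩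
    A i j - 0ℚ                 ≡⟨ ℚ.+-identityʳ (A i j) ⟩
    A i j                      ∎
  ... | tri> i≮j _ j<i = begin
    upper A i j - upper A j i  ≡⟨ cong₂ _-_ (upper-≮ i≮j) (trans (upper-< j<i) (anti i j)) ⟩
    0ℚ - - A i j               ≡⟨ solve 1 (λ x → con 0ℚ :- :- x := x) refl (A i j) ⟩
    A i j                      ∎
  ... | tri≈ i≮j i≡j _ with toℕ-injective i≡j
  ...   | refl = begin
    upper A i i - upper A i i  ≡⟨ cong₂ _-_ (upper-≮ i≮j) (upper-≮ i≮j) ⟩
    0ℚ                         ≡⟨ x≡-x⇒x≡0 (anti i i) ⟨
    A i i                      ∎

Edge : EdgeSet n → Fin n → Fin n → Set
Edge G i j = toℕ i < toℕ j × G i j ≡ true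

Adjacent : EdgeSet n → Fin n → Fin n → Set
Adjacent G i j = Edge G i j ⊎ Edge G j i

ProperColouring : EdgeSet n → (Fin n → Bool) → Set
ProperColouring {n} G χ = ∀ (i j : Fin n) → toℕ i < toℕ j → G i j ≡ true → χ i ≢ χ j

adjacent⇒edge : ∀ {G : EdgeSet n} {i j} → Adjacent G i j → toℕ i < toℕ j → Edge G i j
adjacent⇒edge (inj₁ ij)           _   = ij
adjacent⇒edge (inj₂ (j<i , _)) i<j = contradiction j<i (<-asym i<j)

adjacent⇒colours-≢ : ∀ {G : EdgeSet n} {χ} → ProperColouring G χ →
                     ∀ {i j} → Adjacent G i j → χ i ≢ χ j
adjacent⇒colours-≢ proper (inj₁ (i<j , Gij)) = proper _ _ i<j Gij
adjacent⇒colours-≢ proper (inj₂ (j<i , Gji)) = proper _ _ j<i Gji ∘ sym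

IsSymmetric : (Fin n → Fin n → ℚ) → Set
IsSymmetric T = ∀ i j → T i j ≡ T j i

SupportedOn : EdgeSet n → (Fin n → Fin n → ℚ) → Set
SupportedOn G T = ∀ i j → T i j ≢ 0ℚ → Adjacent G i j

IsHyperStress : Config n d → (Fin n → Fin n → ℚ) → Set
IsHyperStress {n} p T = ∀ k a → ∑[ j < n ] (T k j * p j a) ≡ 0ℚ

IsSelfStress : Config n d → (Fin n → Fin n → ℚ) → Set
IsSelfStress {n} q S = ∀ k a → ∑[ j < n ] (S k j * (q k a - q j a)) ≡ 0ℚ

HyperStressFree : EdgeSet n → Config n d → Set
HyperStressFree G p =
  ∀ {T} → IsSymmetric T → SupportedOn G T → IsHyperStress p T → ∀ i j → T i j ≡ 0ℚ

SelfStressFree : EdgeSet n → Config n d → Set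
SelfStressFree G q =
  ∀ {S} → IsSymmetric S → SupportedOn G S → IsSelfStress q S → ∀ i j → S i j ≡ 0ℚ

independent⇒hyperStressFree : ∀ {G : EdgeSet n} {χ} {p : Config n d} →
  ProperColouring G χ → RowsIndependent (hyperMatrix p) G → HyperStressFree G p
independent⇒hyperStressFree {n} {G = G} {χ} {p} proper indep {T} T-sym T-supp T-stress i j =
  decidable-stable (T i j ℚ.≟ 0ℚ) λ Tij≢0 → case T-supp i j Tij≢0 of λ where
    (inj₁ (i<j , _)) → Tij≢0 (T-above i<j)
    (inj₂ (j<i , _)) → Tij≢0 (trans (T-sym i j) (T-above j<i))
  where
  A : Fin n → Fin n → ℚ
  A i j = sign (χ i) * T i j

  A-antisym : ∀ i j → A j i ≡ - A i j
  A-antisym i j with T i j ℚ.≟ 0ℚ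
  ... | yes Tij≡0 rewrite T-sym j i | Tij≡0 =
    trans (ℚ.*-zeroʳ (sign (χ j))) (cong -_ (sym (ℚ.*-zeroʳ (sign (χ i)))))
  ... | no Tij≢0 rewrite T-sym j i | sign-≢ (adjacent⇒colours-≢ proper (T-supp i j Tij≢0)) =
    sym (ℚ.neg-distribˡ-* (sign (χ i)) (T i j))

  C : Fin n → Fin n → ℚ
  C = upper A

  C-supp : ∀ i j → C i j ≢ 0ℚ → Edge G i j
  C-supp i j Cij≢0 = adjacent⇒edge {G = G} (T-supp i j Tij≢0) i<j
    where
    i<j : toℕ i < toℕ j
    i<j = proj₁ (upper-≢0 A Cij≢0)
    Tij≢0 : T i j ≢ 0ℚ
    Tij≢0 Tij≡0 = proj₂ (upper-≢0 A Cij≢0)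
                        (trans (cong (sign (χ i) *_) Tij≡0) (ℚ.*-zeroʳ (sign (χ i))))

  C-column : ∀ k a → sumFin n (λ i → sumFin n (λ j → C i j * hyperMatrix p i j k a)) ≡ 0ℚ
  C-column k a = begin
    sumFin n (λ i → sumFin n (λ j → C i j * hyperMatrix p i j k a))
      ≡⟨ sumFin-column-hyperMatrix p C k a (upper-≮ A {k} (<-irrefl refl)) ⟩
    ∑[ j < n ] ((C k j - C j k) * p j a)
      ≡⟨ sum-cong-≗ (λ j → cong (_* p j a) (upper-sub A A-antisym k j)) ⟩
    ∑[ j < n ] (sign (χ k) * T k j * p j a)
      ≡⟨ sum-cong-≗ (λ j → ℚ.*-assoc (sign (χ k)) (T k j) (p j a)) ⟩
    ∑[ j < n ] (sign (χ k) * (T k j * p j a))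
      ≡⟨ *-distribˡ-sum (sign (χ k)) (λ j → T k j * p j a) ⟨
    sign (χ k) * ∑[ j < n ] (T k j * p j a)
      ≡⟨ cong (sign (χ k) *_) (T-stress k a) ⟩
    sign (χ k) * 0ℚ
      ≡⟨ ℚ.*-zeroʳ (sign (χ k)) ⟩
    0ℚ
      ∎

  T-above : ∀ {i j} → toℕ i < toℕ j → T i j ≡ 0ℚ
  T-above {i} {j} i<j =
    x*y≡0⇒y≡0 (sign≢0 (χ i)) (trans (sym (upper-< A i<j)) (indep C C-supp C-column i j))

_⊙_ : (Fin n → ℚ) → Config n d → Config n d
(κ ⊙ p) i a = κ i * p i a

hyperStressFree-rescale : ∀ {G : EdgeSet n} {p : Config n d} {κ} →
  HyperStressFree G p → (∀ i → κ i ≢ 0ℚ) → HyperStressFree G (κ ⊙ p)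
hyperStressFree-rescale {n} {G = G} {p} {κ} p-free κ≢0 {T} T-sym T-supp T-stress i j =
  x*y≡0⇒y≡0 (κκ≢0 i j) (p-free T′-sym T′-supp T′-stress i j)
  where
  T′ : Fin n → Fin n → ℚ
  T′ i j = κ i * κ j * T i j

  κκ≢0 : ∀ i j → κ i * κ j ≢ 0ℚ
  κκ≢0 i j = x#0y#0→xy#0 (κ≢0 i) (κ≢0 j)

  T′-sym : IsSymmetric T′
  T′-sym i j = cong₂ _*_ (ℚ.*-comm (κ i) (κ j)) (T-sym i j)

  T′-supp : SupportedOn G T′
  T′-supp i j T′ij≢0 = T-supp i j λ Tij≡0 →
    T′ij≢0 (trans (cong (κ i * κ j *_) Tij≡0) (ℚ.*-zeroʳ (κ i * κ j)))

  T′-stress : IsHyperStress p T′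
  T′-stress k a = begin
    ∑[ j < n ] (κ k * κ j * T k j * p j a)
      ≡⟨ sum-cong-≗ (λ j → solve 4 (λ u v t x → u :* v :* t :* x := u :* (t :* (v :* x))) refl
                                   (κ k) (κ j) (T k j) (p j a)) ⟩
    ∑[ j < n ] (κ k * (T k j * (κ ⊙ p) j a))
      ≡⟨ *-distribˡ-sum (κ k) (λ j → T k j * (κ ⊙ p) j a) ⟨
    κ k * ∑[ j < n ] (T k j * (κ ⊙ p) j a)
      ≡⟨ cong (κ k *_) (T-stress k a) ⟩
    κ k * 0ℚ
      ≡⟨ ℚ.*-zeroʳ (κ k) ⟩
    0ℚ
      ∎

selfStress-balance : ∀ {q : Config n d} {S} → IsSelfStress q S →
  ∀ k a → ∑[ j < n ] (S k j * q j a) ≡ q k a * ∑[ j < n ] S k j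
selfStress-balance {n} {q = q} {S} S-stress k a = begin
  ∑[ j < n ] (S k j * q j a)
    ≡⟨ ℚ.+-identityʳ _ ⟨
  ∑[ j < n ] (S k j * q j a) + 0ℚ
    ≡⟨ cong (∑[ j < n ] (S k j * q j a) +_) (S-stress k a) ⟨
  ∑[ j < n ] (S k j * q j a) + ∑[ j < n ] (S k j * (q k a - q j a))
    ≡⟨ ∑-distrib-+ (λ j → S k j * q j a) (λ j → S k j * (q k a - q j a)) ⟨
  ∑[ j < n ] (S k j * q j a + S k j * (q k a - q j a))
    ≡⟨ sum-cong-≗ (λ j → solve 3 (λ s x y → s :* y :+ s :* (x :- y) := x :* s) refl
                                 (S k j) (q k a) (q j a)) ⟩
  ∑[ j < n ] (q k a * S k j)
    ≡⟨ *-distribˡ-sum (q k a) (S k) ⟨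
  q k a * ∑[ j < n ] S k j
    ∎

_·_ : (Fin d → ℚ) → (Fin d → ℚ) → ℚ
_·_ {d} μ v = ∑[ a < d ] (μ a * v a)

·-scale : ∀ (μ : Fin d → ℚ) x v → μ · (λ a → x * v a) ≡ x * (μ · v)
·-scale {d} μ x v = begin
  ∑[ a < d ] (μ a * (x * v a))
    ≡⟨ sum-cong-≗ (λ a → solve 3 (λ m x y → m :* (x :* y) := x :* (m :* y)) refl (μ a) x (v a)) ⟩
  ∑[ a < d ] (x * (μ a * v a))
    ≡⟨ *-distribˡ-sum x (λ a → μ a * v a) ⟨
  x * (μ · v)
    ∎

·-∑ : ∀ (μ : Fin d → ℚ) (w : Fin n → ℚ) (v : Fin n → Fin d → ℚ) →
      ∑[ j < n ] (w j * (μ · v j)) ≡ μ · (λ a → ∑[ j < n ] (w j * v j a))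
·-∑ {d} {n} μ w v = begin
  ∑[ j < n ] (w j * (μ · v j))
    ≡⟨ sum-cong-≗ (λ j → *-distribˡ-sum (w j) (λ a → μ a * v j a)) ⟩
  ∑[ j < n ] ∑[ a < d ] (w j * (μ a * v j a))
    ≡⟨ ∑-comm (λ j a → w j * (μ a * v j a)) ⟩
  ∑[ a < d ] ∑[ j < n ] (w j * (μ a * v j a))
    ≡⟨ sum-cong-≗ (λ a → sum-cong-≗ (λ j →
         solve 3 (λ w m y → w :* (m :* y) := m :* (w :* y)) refl (w j) (μ a) (v j a))) ⟩
  ∑[ a < d ] ∑[ j < n ] (μ a * (w j * v j a))
    ≡⟨ sum-cong-≗ (λ a → *-distribˡ-sum (μ a) (λ j → w j * v j a)) ⟨
  μ · (λ a → ∑[ j < n ] (w j * v j a))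
    ∎

selfStress-· : ∀ {q : Config n d} {S} → IsSelfStress q S →
  ∀ μ k → ∑[ j < n ] (S k j * (μ · q j)) ≡ ∑[ j < n ] S k j * (μ · q k)
selfStress-· {n} {q = q} {S} S-stress μ k = begin
  ∑[ j < n ] (S k j * (μ · q j))
    ≡⟨ ·-∑ μ (S k) q ⟩
  μ · (λ a → ∑[ j < n ] (S k j * q j a))
    ≡⟨ sum-cong-≗ (λ a → cong (μ a *_) (trans (selfStress-balance {q = q} {S} S-stress k a)
                                               (ℚ.*-comm (q k a) (∑[ j < n ] S k j)))) ⟩
  μ · (λ a → ∑[ j < n ] S k j * q k a)
    ≡⟨ ·-scale μ (∑[ j < n ] S k j) (q k) ⟩
  ∑[ j < n ] S k j * (μ · q k)
    ∎

fromℕ : ℕ → ℚ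
fromℕ k = mkℚ (ℤ.+ k) 0 (coprime-sym (1-coprimeTo k))

fromℕ-injective : ∀ {k l} → fromℕ k ≡ fromℕ l → k ≡ l
fromℕ-injective e = +-injective (cong ↥_ e)

linear-root-unique : ∀ {α β s t} → ¬ (α ≡ 0ℚ × β ≡ 0ℚ) →
                     s * β + α ≡ 0ℚ → t * β + α ≡ 0ℚ → s ≡ t
linear-root-unique {α} {β} {s} {t} nonzero s-root t-root with β ℚ.≟ 0ℚ
... | yes β≡0 = contradiction (α≡0 , β≡0) nonzero
  where
  α≡0 : α ≡ 0ℚ
  α≡0 = trans (sym (trans (cong (λ b → s * b + α) β≡0)
                          (trans (cong (_+ α) (ℚ.*-zeroʳ s)) (ℚ.+-identityˡ α))))
              s-root
... | no β≢0 = x-y≡0⇒x≡y (x*y≡0⇒y≡0 β≢0 (begin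
  β * (s - t)
    ≡⟨ solve 4 (λ a b s t → b :* (s :- t) := (s :* b :+ a) :- (t :* b :+ a)) refl α β s t ⟩
  (s * β + α) - (t * β + α)
    ≡⟨ cong₂ _-_ s-root t-root ⟩
  0ℚ
    ∎))

-- m linear polynomials have at most m roots altogether, so one of the m + 1 values 0, …, m avoids them.
∃-avoiding-roots : ∀ {m} (α β : Fin m → ℚ) →
  ∃ λ t → ∀ i → t * β i + α i ≡ 0ℚ → α i ≡ 0ℚ × β i ≡ 0ℚ
∃-avoiding-roots {m} α β = case any? (λ t → all? (avoids? (candidate t))) of λ where
    (yes (t , t-avoids)) → candidate t , t-avoids
    (no none)            → contradiction none some-candidate-avoids
  where
  Root : ℚ → Fin m → Set
  Root t i = t * β i + α i ≡ 0ℚ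

  Avoids : ℚ → Fin m → Set
  Avoids t i = Root t i → α i ≡ 0ℚ × β i ≡ 0ℚ

  avoids? : ∀ t i → Dec (Avoids t i)
  avoids? t i = (t * β i + α i ℚ.≟ 0ℚ) →-dec ((α i ℚ.≟ 0ℚ) ×-dec (β i ℚ.≟ 0ℚ))

  candidate : Fin (suc m) → ℚ
  candidate t = fromℕ (toℕ t)

  Blocks : ℚ → Fin m → Set
  Blocks t i = Root t i × ¬ (α i ≡ 0ℚ × β i ≡ 0ℚ)

  ¬avoids⇒blocks : ∀ {t i} → ¬ Avoids t i → Blocks t i
  ¬avoids⇒blocks ¬avoids =
    decidable-stable (_ ℚ.≟ 0ℚ) (λ ¬root → ¬avoids (λ root → contradiction root ¬root)) ,
    (λ zero → ¬avoids (λ _ → zero))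

  NoneAvoids : Set
  NoneAvoids = ¬ ∃ λ t → ∀ i → Avoids (candidate t) i

  blocking : NoneAvoids → ∀ t → ∃ λ i → Blocks (candidate t) i
  blocking none t =
    map₂ (¬avoids⇒blocks {candidate t})
         (¬∀⟶∃¬ m _ (avoids? (candidate t)) (λ t-avoids → none (t , t-avoids)))

  some-candidate-avoids : ¬ NoneAvoids
  some-candidate-avoids none with pigeonhole (n<1+n m) (proj₁ ∘ blocking none)
  ... | t₁ , t₂ , t₁<t₂ , same = <-irrefl (fromℕ-injective candidates-equal) t₁<t₂
    where
    blocks₁ : Blocks (candidate t₁) (proj₁ (blocking none t₁))
    blocks₁ = proj₂ (blocking none t₁)
    root₂ : Root (candidate t₂) (proj₁ (blocking none t₁))
    root₂ = subst (Root (candidate t₂)) (sym same) (proj₁ (proj₂ (blocking none t₂)))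
    candidates-equal : candidate t₁ ≡ candidate t₂
    candidates-equal = linear-root-unique (proj₂ blocks₁) (proj₁ blocks₁) root₂

IsNull : (Fin d → ℚ) → Set
IsNull v = ∀ a → v a ≡ 0ℚ

-- Induction on d: the new first coordinate t of μ is chosen to avoid the roots of
-- t ↦ t * v i 0 + μ′ · (tail of v i) for the functional μ′ on the remaining coordinates.
separating-functional : ∀ d {m} (v : Fin m → Fin d → ℚ) →
                        ∃ λ μ → ∀ i → μ · v i ≡ 0ℚ → IsNull (v i)
separating-functional zero    v = (λ ()) , λ _ _ ()
separating-functional (suc d) v with separating-functional d (λ i a → v i (fsuc a))
... | μ , μ-separates with ∃-avoiding-roots (λ i → μ · (λ a → v i (fsuc a))) (λ i → v i fzero)
...   | t , t-avoids = extended , separates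
  where
  extended : Fin (suc d) → ℚ
  extended fzero    = t
  extended (fsuc a) = μ a

  separates : ∀ i → extended · v i ≡ 0ℚ → IsNull (v i)
  separates i e·vi≡0 fzero    = proj₂ (t-avoids i e·vi≡0)
  separates i e·vi≡0 (fsuc a) = μ-separates i (proj₁ (t-avoids i e·vi≡0)) a

if-≢0 : ∀ b {x} → (if b then x else 0ℚ) ≢ 0ℚ → x ≢ 0ℚ
if-≢0 true  ne = ne
if-≢0 false ne = contradiction refl ne

∃-normalising-scalar : ∀ x {y} → y ≢ 0ℚ → ∃ λ κ → κ ≢ 0ℚ × (x ≢ 0ℚ → κ * x ≡ y)
∃-normalising-scalar x {y} y≢0 with x ℚ.≟ 0ℚ
... | yes x≡0 = 1ℚ , (λ ()) , λ x≢0 → contradiction x≡0 x≢0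
... | no  x≢0 = κ , κ≢0 , λ _ → κx≡y
  where
  instance _ = ≢-nonZero x≢0
  κ : ℚ
  κ = y * 1/ x
  κx≡y : κ * x ≡ y
  κx≡y = begin
    y * 1/ x * x    ≡⟨ ℚ.*-assoc y (1/ x) x ⟩
    y * (1/ x * x)  ≡⟨ cong (y *_) (ℚ.*-inverseˡ x) ⟩
    y * 1ℚ          ≡⟨ ℚ.*-identityʳ y ⟩
    y               ∎
  κ≢0 : κ ≢ 0ℚ
  κ≢0 κ≡0 = y≢0 (trans (sym κx≡y) (trans (cong (_* x) κ≡0) (ℚ.*-zeroˡ x)))

IsNormalised : (Fin d → ℚ) → (Fin n → Bool) → Config n d → Set
IsNormalised μ χ q = ∀ i → IsNull (q i) ⊎ μ · q i ≡ sign (χ i)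

∃-normalising-rescaling : (χ : Fin n → Bool) (p : Config n d) →
  ∃₂ λ κ μ → (∀ i → κ i ≢ 0ℚ) × IsNormalised μ χ (κ ⊙ p)
∃-normalising-rescaling {n} {d} χ p with separating-functional d p
... | μ , μ-separates = κ , μ , (λ i → proj₁ (proj₂ (scalar i))) , normalised
  where
  scalar : ∀ i → ∃ λ κ → κ ≢ 0ℚ × (μ · p i ≢ 0ℚ → κ * (μ · p i) ≡ sign (χ i))
  scalar i = ∃-normalising-scalar (μ · p i) (sign≢0 (χ i))

  κ : Fin n → ℚ
  κ i = proj₁ (scalar i)

  normalised : IsNormalised μ χ (κ ⊙ p)
  normalised i = case μ · p i ℚ.≟ 0ℚ of λ where
    (yes μ·pi≡0) → inj₁ λ a → trans (cong (κ i *_) (μ-separates i μ·pi≡0 a)) (ℚ.*-zeroʳ (κ i))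
    (no  μ·pi≢0) → inj₂ (trans (·-scale μ (κ i) (p i)) (proj₂ (proj₂ (scalar i)) μ·pi≢0))

module _ {G : EdgeSet n} {χ : Fin n → Bool} (proper : ProperColouring G χ)
         {q : Config n d} (q-free : HyperStressFree G q)
         {μ : Fin d → ℚ} (normalised : IsNormalised μ χ q) where

  private
    null? : ∀ i → Dec (μ · q i ≡ 0ℚ)
    null? i = μ · q i ℚ.≟ 0ℚ

  null⇒IsNull : ∀ {i} → μ · q i ≡ 0ℚ → IsNull (q i)
  null⇒IsNull {i} μ·qi≡0 with normalised i
  ... | inj₁ qi-null    = qi-null
  ... | inj₂ μ·qi≡sign = contradiction (trans (sym μ·qi≡sign) μ·qi≡0) (sign≢0 (χ i))

  nonnull⇒sign : ∀ {i} → μ · q i ≢ 0ℚ → μ · q i ≡ sign (χ i)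
  nonnull⇒sign {i} μ·qi≢0 with normalised i
  ... | inj₁ qi-null    =
    contradiction (∑-zero λ a → trans (cong (μ a *_) (qi-null a)) (ℚ.*-zeroʳ (μ a))) μ·qi≢0
  ... | inj₂ μ·qi≡sign = μ·qi≡sign

  module _ {S} (S-sym : IsSymmetric S) (S-supp : SupportedOn G S) (S-stress : IsSelfStress q S) where

    selfStress-at-null : ∀ {k} j → μ · q k ≡ 0ℚ → S k j ≡ 0ℚ
    selfStress-at-null {k} j μ·qk≡0 =
      trans (sym (S₀-at-null j μ·qk≡0)) (q-free S₀-sym S₀-supp S₀-hyper k j)
      where
      S₀ : Fin n → Fin n → ℚ
      S₀ i j = if does (null? i) ∨ does (null? j) then S i j else 0ℚ

      S₀-at-null : ∀ {k} j → μ · q k ≡ 0ℚ → S₀ k j ≡ S k j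
      S₀-at-null {k} j μ·qk≡0 =
        cong (λ b → if b ∨ does (null? j) then S k j else 0ℚ) (dec-true (null? k) μ·qk≡0)

      S₀-away : ∀ {k j} → μ · q k ≢ 0ℚ → μ · q j ≢ 0ℚ → S₀ k j ≡ 0ℚ
      S₀-away {k} {j} μ·qk≢0 μ·qj≢0 = cong₂ (λ b b′ → if b ∨ b′ then S k j else 0ℚ)
                                            (dec-false (null? k) μ·qk≢0) (dec-false (null? j) μ·qj≢0)

      S₀-sym : IsSymmetric S₀
      S₀-sym i j = cong₂ (λ b s → if b then s else 0ℚ)
                         (∨-comm (does (null? i)) (does (null? j))) (S-sym i j)

      S₀-supp : SupportedOn G S₀
      S₀-supp i j S₀ij≢0 = S-supp i j (if-≢0 (does (null? i) ∨ does (null? j)) S₀ij≢0)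

      S₀-hyper : IsHyperStress q S₀
      S₀-hyper k a = case null? k of λ where
        (yes μ·qk≡0) → begin
          ∑[ j < n ] (S₀ k j * q j a)  ≡⟨ sum-cong-≗ (λ j → cong (_* q j a) (S₀-at-null j μ·qk≡0)) ⟩
          ∑[ j < n ] (S k j * q j a)   ≡⟨ selfStress-balance {q = q} {S} S-stress k a ⟩
          q k a * ∑[ j < n ] S k j     ≡⟨ cong (_* ∑[ j < n ] S k j) (null⇒IsNull μ·qk≡0 a) ⟩
          0ℚ * ∑[ j < n ] S k j        ≡⟨ ℚ.*-zeroˡ (∑[ j < n ] S k j) ⟩
          0ℚ                           ∎
        (no μ·qk≢0) → ∑-zero λ j → case null? j of λ where
          (yes μ·qj≡0) → trans (cong (S₀ k j *_) (null⇒IsNull μ·qj≡0 a)) (ℚ.*-zeroʳ (S₀ k j))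
          (no  μ·qj≢0) → trans (cong (_* q j a) (S₀-away μ·qk≢0 μ·qj≢0)) (ℚ.*-zeroˡ (q j a))

    neighbour-value : ∀ k j → S k j * (μ · q j) ≡ S k j * - sign (χ k)
    neighbour-value k j with S k j ℚ.≟ 0ℚ
    ... | yes Skj≡0 rewrite Skj≡0 = trans (ℚ.*-zeroˡ (μ · q j)) (sym (ℚ.*-zeroˡ (- sign (χ k))))
    ... | no  Skj≢0 = cong (S k j *_) (trans (nonnull⇒sign μ·qj≢0)
                                      (sign-≢ (adjacent⇒colours-≢ proper (S-supp k j Skj≢0))))
      where
      μ·qj≢0 : μ · q j ≢ 0ℚ
      μ·qj≢0 μ·qj≡0 = Skj≢0 (trans (S-sym k j) (selfStress-at-null k μ·qj≡0))

    selfStress-rowSum≡0 : ∀ k → ∑[ j < n ] S k j ≡ 0ℚ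
    selfStress-rowSum≡0 k with null? k
    ... | yes μ·qk≡0 = ∑-zero λ j → selfStress-at-null j μ·qk≡0
    ... | no  μ·qk≢0 = x*y≡0⇒y≡0 (sign≢0 (χ k))
        (trans (ℚ.*-comm (sign (χ k)) rowSum) (x≡-x⇒x≡0 (begin
          rowSum * sign (χ k)                ≡⟨ cong (rowSum *_) (nonnull⇒sign μ·qk≢0) ⟨
          rowSum * (μ · q k)                 ≡⟨ selfStress-· {q = q} {S} S-stress μ k ⟨
          ∑[ j < n ] (S k j * (μ · q j))     ≡⟨ sum-cong-≗ (neighbour-value k) ⟩
          ∑[ j < n ] (S k j * - sign (χ k))  ≡⟨ *-distribʳ-sum (- sign (χ k)) (S k) ⟨
          rowSum * - sign (χ k)              ≡⟨ ℚ.neg-distribʳ-* rowSum (sign (χ k)) ⟨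
          - (rowSum * sign (χ k))            ∎)))
      where
      rowSum : ℚ
      rowSum = ∑[ j < n ] S k j

  normalised⇒selfStressFree : SelfStressFree G q
  normalised⇒selfStressFree {S} S-sym S-supp S-stress = q-free S-sym S-supp λ k a →
    trans (selfStress-balance {q = q} {S} S-stress k a)
          (trans (cong (q k a *_) (selfStress-rowSum≡0 S-sym S-supp S-stress k)) (ℚ.*-zeroʳ (q k a)))

selfStressFree⇒independent : ∀ {G : EdgeSet n} {q : Config n d} →
  SelfStressFree G q → RowsIndependent (rigidityMatrix q) G
selfStressFree⇒independent {n} {G = G} {q} q-free c c-supp c-column i j =
  decidable-stable (c i j ℚ.≟ 0ℚ) λ cij≢0 → cij≢0 (begin
    c i j        ≡⟨ ℚ.+-identityʳ (c i j) ⟨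
    c i j + 0ℚ   ≡⟨ cong (c i j +_) (c-below (<-asym (proj₁ (c-supp i j cij≢0)))) ⟨
    S i j        ≡⟨ q-free S-sym S-supp S-stress i j ⟩
    0ℚ           ∎)
  where
  c-below : ∀ {i j} → ¬ toℕ i < toℕ j → c i j ≡ 0ℚ
  c-below {i} {j} i≮j =
    decidable-stable (c i j ℚ.≟ 0ℚ) (λ cij≢0 → i≮j (proj₁ (c-supp i j cij≢0)))

  S : Fin n → Fin n → ℚ
  S i j = c i j + c j i

  S-sym : IsSymmetric S
  S-sym i j = ℚ.+-comm (c i j) (c j i)

  S-supp : SupportedOn G S
  S-supp i j Sij≢0 = case c i j ℚ.≟ 0ℚ of λ where
    (no  cij≢0) → inj₁ (c-supp i j cij≢0)
    (yes cij≡0) → inj₂ (c-supp j i (λ cji≡0 → Sij≢0 (cong₂ _+_ cij≡0 cji≡0)))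

  S-stress : IsSelfStress q S
  S-stress k a = trans (sym (sumFin-column-rigidityMatrix q c k a (c-below (<-irrefl refl)))) (c-column k a)

corollary4p5 : (n d : ℕ) (G : EdgeSet n) →
    Bipartite G → IndepH n d G → IndepR n d G
corollary4p5 n d G (χ , proper) (p , indep) with ∃-normalising-rescaling χ p
... | κ , μ , κ≢0 , normalised =
  κ ⊙ p , selfStressFree⇒independent (normalised⇒selfStressFree proper q-free {μ} normalised)
  where
  q-free : HyperStressFree G (κ ⊙ p)
  q-free = hyperStressFree-rescale (independent⇒hyperStressFree proper indep) κ≢0
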